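{- The logic $\mathsf{L}_{\mathsf{S}\mathsf{A}}$ is complete for $\mathcal{L}_{\mathsf{S}\mathsf{A}}$ with respect to expertise frames: every formula $\phi\in\mathcal{L}_{\mathsf{S}\mathsf{A}}$ that is true at every state of every expertise model is a theorem of $\mathsf{L}_{\mathsf{S}\mathsf{A}}$.
   Context: Let $\mathsf{Prop}$ be a countable set of propositional variables and let $\mathcal{L}_{\mathsf{S}\mathsf{A}}$ be the language $\phi ::= p \mid \neg\phi \mid \phi\wedge\phi \mid \mathsf{S}\phi \mid \mathsf{A}\phi$. The logic $\mathsf{L}_{\mathsf{S}\mathsf{A}}$ is classical propositional calculus over $\mathcal{L}_{\mathsf{S}\mathsf{A}}$ extended with axioms $\mathsf{S}\phi\wedge\neg\mathsf{S}\psi\rightarrow\mathsf{S}(\phi\wedge\neg\psi)$; $\phi\rightarrow\mathsf{S}\phi$; $\mathsf{S}\neg\mathsf{S}\phi\rightarrow\neg\mathsf{S}\phi$; $\mathsf{A}(\phi\rightarrow\psi)\rightarrow(\mathsf{A}\phi\rightarrow\mathsf{A}\psi)$; $\mathsf{A}\phi\rightarrow\phi$; $\neg\mathsf{A}\phi\rightarrow\mathsf{A}\neg\mathsf{A}\phi$; $\mathsf{A}\phi\rightarrow\neg\mathsf{S}\neg\phi$; and rules modus ponens, from $\phi$ infer $\mathsf{A}\phi$, and from $\phi\leftrightarrow\psi$ infer $\mathsf{S}\phi\leftrightarrow\mathsf{S}\psi$. An expertise frame is $(X,P)$ with $P\subseteq 2^X$ satisfying (P1) $X\in P$, (P2) $A\in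 P\Rightarrow X\setminus A\in P$, (P3) closure under arbitrary intersections; an expertise model adds $v:\mathsf{Prop}\to2^X$. Satisfaction: atoms and Boolean connectives standard; $M,x\vDash\mathsf{S}\phi$ iff for all $A\in P$, $\|\phi\|_M\subseteq A$ implies $x\in A$; $M,x\vDash\mathsf{A}\phi$ iff $M,y\vDash\phi$ for all $y\in X$; $\|\phi\|_M=\{x\mid M,x\vDash\phi\}$. -}

module Defs where

open import Data.Nat using (ℕ)
open import Data.Unit using (⊤)
open import Data.Bool using (Bool; true; false; not; _∧_)
open import Data.Product using (_×_; Σ)
open import Relation.Nullary using (¬_)
open import Relation.Binary.PropositionalEquality using (_≡_)
open import Level using (suc; zero; Lift)

Var : Set
Var = ℕ

data Form : Set where
  var : Var → Form
  ~_  : Form → Form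
  _&_ : Form → Form → Form
  S   : Form → Form
  A   : Form → Form

infix 8 ~_
infixr 6 _&_
infixr 4 _⇒_ _⇔_

_⇒_ : Form → Form → Form
φ ⇒ ψ = ~ (φ & ~ ψ)

_⇔_ : Form → Form → Form
φ ⇔ ψ = (φ ⇒ ψ) & (ψ ⇒ φ)

-- Classical propositional tautologies: formulas true under every Boolean
-- valuation in which S- and A-formulas are treated as atoms.
evalB : (Form → Bool) → Form → Bool
evalB w (var p) = w (var p)
evalB w (~ φ)   = not (evalB w φ)
evalB w (φ & ψ) = evalB w φ ∧ evalB w ψ
evalB w (S φ)   = w (S φ)
evalB w (A φ)   = w (A φ)

Tautology : Form → Set
Tautology φ = (w : Form → Bool) → evalB w φ ≡ true

data ⊢_ : Form → Set where
  taut  : ∀ {φ} → Tautology φ → ⊢ φ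
  ax-S1 : ∀ φ ψ → ⊢ ((S φ & ~ S ψ) ⇒ S (φ & ~ ψ))
  ax-S2 : ∀ φ → ⊢ (φ ⇒ S φ)
  ax-S3 : ∀ φ → ⊢ (S (~ S φ) ⇒ ~ S φ)
  ax-K  : ∀ φ ψ → ⊢ (A (φ ⇒ ψ) ⇒ (A φ ⇒ A ψ))
  ax-T  : ∀ φ → ⊢ (A φ ⇒ φ)
  ax-5  : ∀ φ → ⊢ (~ A φ ⇒ A (~ A φ))
  ax-AS : ∀ φ → ⊢ (A φ ⇒ ~ S (~ φ))
  mp    : ∀ {φ ψ} → ⊢ (φ ⇒ ψ) → ⊢ φ → ⊢ ψ
  nec   : ∀ {φ} → ⊢ φ → ⊢ A φ
  reS   : ∀ {φ ψ} → ⊢ (φ ⇔ ψ) → ⊢ (S φ ⇔ S ψ)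

Subset : Set → Set₁
Subset X = X → Set

_⊆_ : ∀ {X} → Subset X → Subset X → Set
U ⊆ V = ∀ x → U x → V x

record Frame : Set₂ where
  field
    X  : Set
    P  : Subset X → Set
    -- P is a family of subsets (sets are extensional)
    P-ext  : ∀ {U V} → U ⊆ V → V ⊆ U → P U → P V
    P1 : P (λ _ → ⊤)
    P2 : ∀ {U} → P U → P (λ x → ¬ U x)
    P3 : (I : Set) (U : I → Subset X) → (∀ i → P (U i)) →
         P (λ x → ∀ i → U i x)

record Model : Set₂ where
  field
    frame : Frame
  open Frame frame public
  field
    val : Var → Subset X

open Model

infix 2 _,_⊨_
_,_⊨_ : (M : Model) → X M → Form → Set₁
M , x ⊨ var p   = Lift (suc zero) (val M p x)
M , x ⊨ ~ φ     = ¬ (M , x ⊨ φ)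
M , x ⊨ (φ & ψ) = (M , x ⊨ φ) × (M , x ⊨ ψ)
M , x ⊨ S φ     = ∀ (U : Subset (X M)) → P M U → (∀ y → M , y ⊨ φ → U y) → U x
M , x ⊨ A φ     = ∀ y → M , y ⊨ φ

Valid : Form → Set₂
Valid φ = ∀ (M : Model) (x : X M) → M , x ⊨ φ

-- Pratt-style elimination of Hintikka types. Let Φ be the atoms of φ: its variables and its
-- subformulas headed by S or A. A type is a Boolean valuation t, and ⟪ t ⟫ Φ is its
-- characteristic conjunction of literals; the disjunction of the characteristic formulas of all
-- types is a tautology. A type is discarded when it violates χ → S χ or A χ → χ, when it makes
-- S χ true but no remaining type agreeing with it on the modal atoms makes χ true, or when it
-- makes A χ false but no remaining type agreeing with it on the A-atoms makes χ false. Every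
-- discarded type is refutable: the conjunction σ of its modal literals satisfies σ → □ σ, so
-- ⊢ ¬ (σ ∧ χ) yields ⊢ σ → ¬ S χ (dually for A). Hence the disjunction over the remaining types
-- stays a theorem. Once nothing more can be discarded, the remaining types that agree with a
-- fixed one on the A-atoms form an expertise model, with P the sets closed under agreement on
-- the modal atoms, in which each type satisfies exactly the formulas it makes true. So if φ is
-- valid, every remaining characteristic formula implies φ, and φ is a theorem.

module Submission where

open import Defs hiding (_⊆_)
open import Data.Bool as Bool using (Bool; true; false; not; _∧_; T; if_then_else_)
open import Data.Bool.Properties using (∧-conicalˡ; ∧-conicalʳ; ¬-not)
open import Data.Empty using (⊥-elim)
open import Data.List using (List; []; _∷_; _++_; map; filter; length; cartesianProductWith)
open import Data.List.Properties using (filter-notAll)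
open import Data.List.Membership.Propositional using (_∈_; lose; find)
open import Data.List.Membership.Propositional.Properties
  using (∈-++⁺ˡ; ∈-++⁺ʳ; ∈-++⁻; ∈-map⁺; ∈-map⁻; ∈-filter⁺; ∈-filter⁻; ∈-cartesianProductWith⁺)
open import Data.List.Relation.Binary.Subset.Propositional using (_⊆_)
open import Data.List.Relation.Unary.All as All using (All; []; _∷_)
import Data.List.Relation.Unary.All.Properties as All
open import Data.List.Relation.Unary.All.Properties using (¬All⇒Any¬; all-filter)
open import Data.List.Relation.Unary.Any as Any using (Any; here; there)
open import Data.Nat as ℕ using (ℕ; zero; suc; _≤_; _<_; s≤s⁻¹)
open import Data.Nat.Properties using (≤-refl; <-≤-trans)
open import Data.Product using (_×_; _,_; proj₁; proj₂; ∃; uncurry)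
open import Data.Sum using (inj₁; inj₂)
open import Data.Unit using (⊤; tt)
open import Function using (id; _∘_; const)
open import Level using (lift; lower)
open import Relation.Binary.Definitions using (DecidableEquality)
open import Relation.Binary.PropositionalEquality using (_≡_; _≢_; refl; sym; trans; cong; cong₂)
open import Relation.Nullary using (¬_; Dec; yes; no; does; ¬?)
open import Relation.Nullary.Decidable using (map′; _×-dec_; _→-dec_; decidable-stable)
open import Relation.Unary using (Decidable)

Valuation : Set
Valuation = Form → Bool

variable
  ψ χ θ : Form
  u w t : Valuation
  Γ : List Form

infix 4 _⊩_
record _⊩_ (w : Valuation) (ψ : Form) : Set where
  constructor holds
  field evalB≡true : evalB w ψ ≡ true
open _⊩_

⊩-~⁺ : ¬ w ⊩ ψ → w ⊩ ~ ψ
⊩-~⁺ {w} {ψ} h with evalB w ψ in eq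
... | true  = ⊥-elim (h (holds eq))
... | false = holds (cong not eq)

⊩-~⁻ : w ⊩ ~ ψ → ¬ w ⊩ ψ
⊩-~⁻ {w} {ψ} (holds h) (holds p) with evalB w ψ
⊩-~⁻ (holds ()) (holds refl) | true

⊩-&⁺ : w ⊩ ψ → w ⊩ χ → w ⊩ (ψ & χ)
⊩-&⁺ (holds p) (holds q) = holds (cong₂ _∧_ p q)

⊩-&⁻ : w ⊩ (ψ & χ) → w ⊩ ψ × w ⊩ χ
⊩-&⁻ (holds h) = holds (∧-conicalˡ _ _ h) , holds (∧-conicalʳ _ _ h)

⊩-⇒⁺ : (w ⊩ ψ → w ⊩ χ) → w ⊩ (ψ ⇒ χ)
⊩-⇒⁺ f = ⊩-~⁺ λ h → ⊩-~⁻ (proj₂ (⊩-&⁻ h)) (f (proj₁ (⊩-&⁻ h)))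

⊩-⇒⁻ : w ⊩ (ψ ⇒ χ) → w ⊩ ψ → w ⊩ χ
⊩-⇒⁻ {w} {ψ} {χ} h p with evalB w χ in eq
... | true  = holds eq
... | false = ⊥-elim (⊩-~⁻ h (⊩-&⁺ p (holds (cong not eq))))

_⊩?_ : ∀ w ψ → Dec (w ⊩ ψ)
w ⊩? ψ = map′ holds evalB≡true (evalB w ψ Bool.≟ true)

⊢-semantic : (∀ w → w ⊩ ψ) → ⊢ ψ
⊢-semantic h = taut (evalB≡true ∘ h)

BoolFun : ℕ → Set
BoolFun zero    = Bool
BoolFun (suc n) = Bool → BoolFun n

Tautologous : ∀ n → BoolFun n → Set
Tautologous zero    b = b ≡ true
Tautologous (suc n) f = ∀ x → Tautologous n (f x)

-- For a closed f this reduces to a product of ⊤s, which Agda fills in by eta: callers of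
-- truth-table never supply the check.
TruthTable : ∀ n → BoolFun n → Set
TruthTable zero    b = T b
TruthTable (suc n) f = TruthTable n (f true) × TruthTable n (f false)

truth-table : ∀ n (f : BoolFun n) → {TruthTable n f} → Tautologous n f
truth-table zero    true                = refl
truth-table (suc n) f {rows , _} true  = truth-table n (f true) {rows}
truth-table (suc n) f {_ , rows} false = truth-table n (f false) {rows}

-- Defined exactly like _⇒_ and _⇔_, so that evalB w (ψ ⇒ χ) reduces to evalB w ψ ⇒ᵇ evalB w χ.
infixr 4 _⇒ᵇ_ _⇔ᵇ_
_⇒ᵇ_ _⇔ᵇ_ : Bool → Bool → Bool
x ⇒ᵇ y = not (x ∧ not y)
x ⇔ᵇ y = (x ⇒ᵇ y) ∧ (y ⇒ᵇ x)

⊤ᶠ ⊥ᶠ : Form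
⊤ᶠ = var 0 ⇒ var 0
⊥ᶠ = ~ ⊤ᶠ

□ : Form → Form
□ ψ = ~ S (~ ψ)

mp₂ : ⊢ (ψ ⇒ χ ⇒ θ) → ⊢ ψ → ⊢ χ → ⊢ θ
mp₂ h p q = mp (mp h p) q

mp₃ : ∀ {ρ} → ⊢ (ψ ⇒ χ ⇒ θ ⇒ ρ) → ⊢ ψ → ⊢ χ → ⊢ θ → ⊢ ρ
mp₃ h p q r = mp (mp₂ h p q) r

⊢⊤ᶠ : ⊢ ⊤ᶠ
⊢⊤ᶠ = ⊢-semantic λ _ → ⊩-⇒⁺ id

⇒-trans : ⊢ (ψ ⇒ χ) → ⊢ (χ ⇒ θ) → ⊢ (ψ ⇒ θ)
⇒-trans {ψ} {χ} {θ} = mp₂ (taut λ w →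
  truth-table 3 (λ x y z → (x ⇒ᵇ y) ⇒ᵇ (y ⇒ᵇ z) ⇒ᵇ (x ⇒ᵇ z))
    (evalB w ψ) (evalB w χ) (evalB w θ))

const⇒ : ⊢ χ → ⊢ (ψ ⇒ χ)
const⇒ {χ} {ψ} = mp (taut λ w →
  truth-table 2 (λ x y → y ⇒ᵇ x ⇒ᵇ y) (evalB w ψ) (evalB w χ))

ex-falso : ⊢ (~ ψ) → ⊢ (ψ ⇒ χ)
ex-falso {ψ} {χ} = mp (taut λ w →
  truth-table 2 (λ x y → not x ⇒ᵇ x ⇒ᵇ y) (evalB w ψ) (evalB w χ))

⋀ ⋁ : List Form → Form
⋀ []      = ⊤ᶠ
⋀ (γ ∷ Γ) = γ & ⋀ Γ
⋁ []      = ⊥ᶠ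
⋁ (γ ∷ Γ) = ~ (~ γ & ~ ⋁ Γ)

⊩-⋀⁺ : All (w ⊩_) Γ → w ⊩ ⋀ Γ
⊩-⋀⁺ []       = ⊩-⇒⁺ id
⊩-⋀⁺ (p ∷ ps) = ⊩-&⁺ p (⊩-⋀⁺ ps)

⊩-⋀⁻ : w ⊩ ⋀ Γ → All (w ⊩_) Γ
⊩-⋀⁻ {Γ = []}    _ = []
⊩-⋀⁻ {Γ = _ ∷ _} h = proj₁ (⊩-&⁻ h) ∷ ⊩-⋀⁻ (proj₂ (⊩-&⁻ h))

⊩-⋁⁺ : Any (w ⊩_) Γ → w ⊩ ⋁ Γ
⊩-⋁⁺ (here p)  = ⊩-~⁺ λ h → ⊩-~⁻ (proj₁ (⊩-&⁻ h)) p
⊩-⋁⁺ (there p) = ⊩-~⁺ λ h → ⊩-~⁻ (proj₂ (⊩-&⁻ h)) (⊩-⋁⁺ p)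

⋁-intro : ∀ {γ} → γ ∈ Γ → ⊢ (γ ⇒ ⋁ Γ)
⋁-intro γ∈ = ⊢-semantic λ w → ⊩-⇒⁺ (⊩-⋁⁺ ∘ lose γ∈)

⋁-elim : (∀ {γ} → γ ∈ Γ → ⊢ (γ ⇒ ψ)) → ⊢ (⋁ Γ ⇒ ψ)
⋁-elim {[]}    _ = ⊢-semantic λ _ → ⊩-⇒⁺ λ h → ⊥-elim (⊩-~⁻ h (⊩-⇒⁺ id))
⋁-elim {γ ∷ Γ} {ψ} h = mp₂ glue (h (here refl)) (⋁-elim (h ∘ there))
  where
  glue : ⊢ ((γ ⇒ ψ) ⇒ (⋁ Γ ⇒ ψ) ⇒ ⋁ (γ ∷ Γ) ⇒ ψ)
  glue = taut λ w →
    truth-table 3 (λ x y z → (x ⇒ᵇ z) ⇒ᵇ (y ⇒ᵇ z) ⇒ᵇ not (not x ∧ not y) ⇒ᵇ z)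
           (evalB w γ) (evalB w (⋁ Γ)) (evalB w ψ)

module _ (O : Form → Form) (O-⊤ᶠ : ⊢ O ⊤ᶠ)
         (O-& : ∀ {ψ χ} → ⊢ (O ψ ⇒ O χ ⇒ O (ψ & χ))) where

  ⋀-stable : All (λ γ → ⊢ (γ ⇒ O γ)) Γ → ⊢ (⋀ Γ ⇒ O (⋀ Γ))
  ⋀-stable []                         = const⇒ O-⊤ᶠ
  ⋀-stable {γ ∷ Γ} (γ-stable ∷ Γ-stable) = mp₃ glue γ-stable (⋀-stable Γ-stable) O-&
    where
    glue : ⊢ ((γ ⇒ O γ) ⇒ (⋀ Γ ⇒ O (⋀ Γ)) ⇒ (O γ ⇒ O (⋀ Γ) ⇒ O (γ & ⋀ Γ)) ⇒
              (γ & ⋀ Γ) ⇒ O (γ & ⋀ Γ))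
    glue = taut λ w →
      truth-table 5 (λ x y p q r → (x ⇒ᵇ p) ⇒ᵇ (y ⇒ᵇ q) ⇒ᵇ (p ⇒ᵇ q ⇒ᵇ r) ⇒ᵇ (x ∧ y) ⇒ᵇ r)
        (evalB w γ) (evalB w (⋀ Γ)) (evalB w (O γ)) (evalB w (O (⋀ Γ))) (evalB w (O (γ & ⋀ Γ)))

⊢□⊤ᶠ : ⊢ □ ⊤ᶠ
⊢□⊤ᶠ = mp (ax-AS ⊤ᶠ) (nec ⊢⊤ᶠ)

S-mono : ⊢ (ψ ⇒ χ) → ⊢ (S ψ ⇒ S χ)
S-mono {ψ} {χ} ψ⇒χ = mp₃ glue (ax-S1 ψ χ) (reS ψ∧¬χ⇔⊥) ⊢□⊤ᶠ
  where
  ψ∧¬χ⇔⊥ : ⊢ ((ψ & ~ χ) ⇔ ⊥ᶠ)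
  ψ∧¬χ⇔⊥ = mp (taut λ w →
    truth-table 3 (λ x y z → (x ⇒ᵇ y) ⇒ᵇ ((x ∧ not y) ⇔ᵇ not (z ⇒ᵇ z)))
      (evalB w ψ) (evalB w χ) (w (var 0))) ψ⇒χ
  glue : ⊢ (((S ψ & ~ S χ) ⇒ S (ψ & ~ χ)) ⇒ (S (ψ & ~ χ) ⇔ S ⊥ᶠ) ⇒ □ ⊤ᶠ ⇒ S ψ ⇒ S χ)
  glue = taut λ w →
    truth-table 4 (λ x y z v → ((x ∧ not y) ⇒ᵇ z) ⇒ᵇ (z ⇔ᵇ v) ⇒ᵇ not v ⇒ᵇ x ⇒ᵇ y)
      (w (S ψ)) (w (S χ)) (w (S (ψ & ~ χ))) (w (S ⊥ᶠ))

□-& : ⊢ (□ ψ ⇒ □ χ ⇒ □ (ψ & χ))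
□-& {ψ} {χ} = mp₂ glue (ax-S1 (~ (ψ & χ)) (~ ψ)) (S-mono ¬χ)
  where
  ¬χ : ⊢ ((~ (ψ & χ) & ~ ~ ψ) ⇒ ~ χ)
  ¬χ = taut λ w →
    truth-table 2 (λ x y → (not (x ∧ y) ∧ not (not x)) ⇒ᵇ not y) (evalB w ψ) (evalB w χ)
  glue : ⊢ (((S (~ (ψ & χ)) & ~ S (~ ψ)) ⇒ S (~ (ψ & χ) & ~ ~ ψ)) ⇒
            (S (~ (ψ & χ) & ~ ~ ψ) ⇒ S (~ χ)) ⇒ □ ψ ⇒ □ χ ⇒ □ (ψ & χ))
  glue = taut λ w →
    truth-table 4 (λ x y z v → ((x ∧ not y) ⇒ᵇ z) ⇒ᵇ (z ⇒ᵇ v) ⇒ᵇ not y ⇒ᵇ not v ⇒ᵇ not x)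
      (w (S (~ (ψ & χ)))) (w (S (~ ψ))) (w (S (~ (ψ & χ) & ~ ~ ψ))) (w (S (~ χ)))

S-□-stable : ⊢ (S ψ ⇒ □ (S ψ))
S-□-stable {ψ} = mp (taut λ w →
  truth-table 2 (λ x y → (y ⇒ᵇ not x) ⇒ᵇ x ⇒ᵇ not y) (w (S ψ)) (w (S (~ S ψ)))) (ax-S3 ψ)

S-idem : ⊢ (S (S ψ) ⇒ S ψ)
S-idem {ψ} = ⇒-trans (S-mono S-□-stable) (mp₂ glue (ax-S2 (~ S ψ)) (ax-S3 (~ S ψ)))
  where
  glue : ⊢ ((~ S ψ ⇒ S (~ S ψ)) ⇒ (S (~ S (~ S ψ)) ⇒ ~ S (~ S ψ)) ⇒ S (□ (S ψ)) ⇒ S ψ)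
  glue = taut λ w →
    truth-table 3 (λ x y z → (not x ⇒ᵇ y) ⇒ᵇ (z ⇒ᵇ not y) ⇒ᵇ z ⇒ᵇ x)
      (w (S ψ)) (w (S (~ S ψ))) (w (S (□ (S ψ))))

¬S-□-stable : ⊢ (~ S ψ ⇒ □ (~ S ψ))
¬S-□-stable {ψ} = mp₂ glue (reS ¬¬Sψ⇔Sψ) S-idem
  where
  ¬¬Sψ⇔Sψ : ⊢ (~ ~ S ψ ⇔ S ψ)
  ¬¬Sψ⇔Sψ = taut λ w → truth-table 1 (λ x → not (not x) ⇔ᵇ x) (w (S ψ))
  glue : ⊢ ((S (~ ~ S ψ) ⇔ S (S ψ)) ⇒ (S (S ψ) ⇒ S ψ) ⇒ ~ S ψ ⇒ □ (~ S ψ))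
  glue = taut λ w →
    truth-table 3 (λ x y z → (y ⇔ᵇ z) ⇒ᵇ (z ⇒ᵇ x) ⇒ᵇ not x ⇒ᵇ not y)
      (w (S ψ)) (w (S (~ ~ S ψ))) (w (S (S ψ)))

S-excludes : ⊢ (θ ⇒ □ θ) → ⊢ (~ (θ & χ)) → ⊢ (θ ⇒ ~ S χ)
S-excludes {θ} {χ} θ-stable ¬θ∧χ = mp₂ glue θ-stable (S-mono (mp χ⇒¬θ ¬θ∧χ))
  where
  χ⇒¬θ : ⊢ (~ (θ & χ) ⇒ χ ⇒ ~ θ)
  χ⇒¬θ = taut λ w →
    truth-table 2 (λ x y → not (x ∧ y) ⇒ᵇ y ⇒ᵇ not x) (evalB w θ) (evalB w χ)
  glue : ⊢ ((θ ⇒ □ θ) ⇒ (S χ ⇒ S (~ θ)) ⇒ θ ⇒ ~ S χ)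
  glue = taut λ w →
    truth-table 3 (λ s x y → (s ⇒ᵇ not y) ⇒ᵇ (x ⇒ᵇ y) ⇒ᵇ s ⇒ᵇ not x)
      (evalB w θ) (w (S χ)) (w (S (~ θ)))

A-mono : ⊢ (ψ ⇒ χ) → ⊢ (A ψ ⇒ A χ)
A-mono h = mp (ax-K _ _) (nec h)

A-& : ⊢ (A ψ ⇒ A χ ⇒ A (ψ & χ))
A-& {ψ} {χ} = ⇒-trans (A-mono pair) (ax-K χ (ψ & χ))
  where
  pair : ⊢ (ψ ⇒ χ ⇒ (ψ & χ))
  pair = taut λ w → truth-table 2 (λ x y → x ⇒ᵇ y ⇒ᵇ (x ∧ y)) (evalB w ψ) (evalB w χ)

A-idem : ⊢ (A ψ ⇒ A (A ψ))
A-idem {ψ} = ⇒-trans (mp₂ glue (ax-T (~ A ψ)) (ax-5 (~ A ψ))) (A-mono ¬A¬Aψ⇒Aψ)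
  where
  ¬A¬Aψ⇒Aψ : ⊢ (~ A (~ A ψ) ⇒ A ψ)
  ¬A¬Aψ⇒Aψ = mp (taut λ w →
    truth-table 2 (λ x y → (not x ⇒ᵇ y) ⇒ᵇ not y ⇒ᵇ x) (w (A ψ)) (w (A (~ A ψ)))) (ax-5 ψ)
  glue : ⊢ ((A (~ A ψ) ⇒ ~ A ψ) ⇒ (~ A (~ A ψ) ⇒ A (~ A (~ A ψ))) ⇒ A ψ ⇒ A (~ A (~ A ψ)))
  glue = taut λ w →
    truth-table 3 (λ x y z → (y ⇒ᵇ not x) ⇒ᵇ (not y ⇒ᵇ z) ⇒ᵇ x ⇒ᵇ z)
      (w (A ψ)) (w (A (~ A ψ))) (w (A (~ A (~ A ψ))))

A-□-stable : ⊢ (A ψ ⇒ □ (A ψ))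
A-□-stable {ψ} = ⇒-trans A-idem (ax-AS (A ψ))

¬A-□-stable : ⊢ (~ A ψ ⇒ □ (~ A ψ))
¬A-□-stable {ψ} = ⇒-trans (ax-5 ψ) (ax-AS (~ A ψ))

lit : Bool → Form → Form
lit true  ψ = ψ
lit false ψ = ~ ψ

⊩-lit⁺ : ∀ {b} → evalB w ψ ≡ b → w ⊩ lit b ψ
⊩-lit⁺ {b = true}  eq = holds eq
⊩-lit⁺ {b = false} eq = holds (cong not eq)

⊩-lit⁻ : ∀ {b} → w ⊩ lit b ψ → evalB w ψ ≡ b
⊩-lit⁻ {b = true}  h = evalB≡true h
⊩-lit⁻ {b = false} h = ¬-not (⊩-~⁻ h ∘ holds)

data Modal : Form → Set where
  S-modal : ∀ ψ → Modal (S ψ)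
  A-modal : ∀ ψ → Modal (A ψ)

data Global : Form → Set where
  A-global : ∀ ψ → Global (A ψ)

modal? : Decidable Modal
modal? (var _) = no λ ()
modal? (~ _)   = no λ ()
modal? (_ & _) = no λ ()
modal? (S ψ)   = yes (S-modal ψ)
modal? (A ψ)   = yes (A-modal ψ)

global? : Decidable Global
global? (var _) = no λ ()
global? (~ _)   = no λ ()
global? (_ & _) = no λ ()
global? (S _)   = no λ ()
global? (A ψ)   = yes (A-global ψ)

lit-□-stable : Modal ψ → ∀ b → ⊢ (lit b ψ ⇒ □ (lit b ψ))
lit-□-stable (S-modal ψ) true  = S-□-stable
lit-□-stable (S-modal ψ) false = ¬S-□-stable
lit-□-stable (A-modal ψ) true  = A-□-stable
lit-□-stable (A-modal ψ) false = ¬A-□-stable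

lit-A-stable : Global ψ → ∀ b → ⊢ (lit b ψ ⇒ A (lit b ψ))
lit-A-stable (A-global ψ) true  = A-idem
lit-A-stable (A-global ψ) false = ax-5 ψ

_≟_ : DecidableEquality Form
var m   ≟ var n   = map′ (cong var) (λ { refl → refl }) (m ℕ.≟ n)
(~ ψ)   ≟ (~ χ)   = map′ (cong ~_) (λ { refl → refl }) (ψ ≟ χ)
(ψ & χ) ≟ (ψ′ & χ′) = map′ (uncurry (cong₂ _&_)) (λ { refl → refl , refl }) (ψ ≟ ψ′ ×-dec χ ≟ χ′)
S ψ     ≟ S χ     = map′ (cong S) (λ { refl → refl }) (ψ ≟ χ)
A ψ     ≟ A χ     = map′ (cong A) (λ { refl → refl }) (ψ ≟ χ)
var _   ≟ (~ _)   = no λ ()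
var _   ≟ (_ & _) = no λ ()
var _   ≟ S _     = no λ ()
var _   ≟ A _     = no λ ()
(~ _)   ≟ var _   = no λ ()
(~ _)   ≟ (_ & _) = no λ ()
(~ _)   ≟ S _     = no λ ()
(~ _)   ≟ A _     = no λ ()
(_ & _) ≟ var _   = no λ ()
(_ & _) ≟ (~ _)   = no λ ()
(_ & _) ≟ S _     = no λ ()
(_ & _) ≟ A _     = no λ ()
S _     ≟ var _   = no λ ()
S _     ≟ (~ _)   = no λ ()
S _     ≟ (_ & _) = no λ ()
S _     ≟ A _     = no λ ()
A _     ≟ var _   = no λ ()
A _     ≟ (~ _)   = no λ ()
A _     ≟ (_ & _) = no λ ()
A _     ≟ S _     = no λ ()

atoms : Form → List Form
atoms (var p) = var p ∷ []
atoms (~ ψ)   = atoms ψ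
atoms (ψ & χ) = atoms ψ ++ atoms χ
atoms (S ψ)   = S ψ ∷ atoms ψ
atoms (A ψ)   = A ψ ∷ atoms ψ

atoms-closed : ∀ θ → ψ ∈ atoms θ → atoms ψ ⊆ atoms θ
atoms-closed (var p) (here refl) = id
atoms-closed (~ θ)   ψ∈        = atoms-closed θ ψ∈
atoms-closed (θ & χ) ψ∈ with ∈-++⁻ (atoms θ) ψ∈
... | inj₁ ψ∈θ = ∈-++⁺ˡ ∘ atoms-closed θ ψ∈θ
... | inj₂ ψ∈χ = ∈-++⁺ʳ (atoms θ) ∘ atoms-closed χ ψ∈χ
atoms-closed (S θ)   (here refl) = id
atoms-closed (S θ)   (there ψ∈)  = there ∘ atoms-closed θ ψ∈
atoms-closed (A θ)   (here refl) = id
atoms-closed (A θ)   (there ψ∈)  = there ∘ atoms-closed θ ψ∈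

Agree : List Form → Valuation → Valuation → Set
Agree Ψ u t = All (λ a → u a ≡ t a) Ψ

Agree-refl : ∀ {Ψ} → Agree Ψ t t
Agree-refl = All.universal (λ _ → refl) _

Agree-sym : ∀ {Ψ} → Agree Ψ u t → Agree Ψ t u
Agree-sym = All.map sym

Agree-trans : ∀ {Ψ v} → Agree Ψ u t → Agree Ψ t v → Agree Ψ u v
Agree-trans p q = All.zipWith (uncurry trans) (p , q)

⊩-agree-modal : ∀ {Ψ a} → Modal a → a ∈ Ψ → Agree Ψ u t → u ⊩ a → t ⊩ a
⊩-agree-modal (S-modal _) a∈ agree (holds h) = holds (trans (sym (All.lookup agree a∈)) h)
⊩-agree-modal (A-modal _) a∈ agree (holds h) = holds (trans (sym (All.lookup agree a∈)) h)

agree? : ∀ Ψ u t → Dec (Agree Ψ u t)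
agree? Ψ u t = All.all? (λ a → u a Bool.≟ t a) Ψ

evalB-atoms : ∀ ψ → Agree (atoms ψ) (evalB u) t → evalB u ψ ≡ evalB t ψ
evalB-atoms (var p) (eq ∷ []) = eq
evalB-atoms (~ ψ)   agree     = cong not (evalB-atoms ψ agree)
evalB-atoms (ψ & χ) agree     =
  cong₂ _∧_ (evalB-atoms ψ (All.++⁻ˡ (atoms ψ) agree)) (evalB-atoms χ (All.++⁻ʳ (atoms ψ) agree))
evalB-atoms (S ψ)   (eq ∷ _)  = eq
evalB-atoms (A ψ)   (eq ∷ _)  = eq

⟪_⟫ : Valuation → List Form → Form
⟪ t ⟫ Ψ = ⋀ (map (λ a → lit (t a) a) Ψ)

⊩-⟪⟫⁺ : ∀ {Ψ} → Agree Ψ (evalB u) t → u ⊩ ⟪ t ⟫ Ψ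
⊩-⟪⟫⁺ agree = ⊩-⋀⁺ (All.map⁺ (All.map ⊩-lit⁺ agree))

⊩-⟪⟫⁻ : ∀ {Ψ} → u ⊩ ⟪ t ⟫ Ψ → Agree Ψ (evalB u) t
⊩-⟪⟫⁻ h = All.map ⊩-lit⁻ (All.map⁻ (⊩-⋀⁻ h))

⟪⟫-entails : ∀ {Ψ} → (∀ u → Agree Ψ (evalB u) t → u ⊩ ψ) → ⊢ (⟪ t ⟫ Ψ ⇒ ψ)
⟪⟫-entails h = ⊢-semantic λ u → ⊩-⇒⁺ (h u ∘ ⊩-⟪⟫⁻)

⟪⟫-□-stable : ∀ {Ψ} → All Modal Ψ → ⊢ (⟪ t ⟫ Ψ ⇒ □ (⟪ t ⟫ Ψ))
⟪⟫-□-stable modal = ⋀-stable □ ⊢□⊤ᶠ □-& (All.map⁺ (All.map (λ m → lit-□-stable m _) modal))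

⟪⟫-A-stable : ∀ {Ψ} → All Global Ψ → ⊢ (⟪ t ⟫ Ψ ⇒ A (⟪ t ⟫ Ψ))
⟪⟫-A-stable global = ⋀-stable A (nec ⊢⊤ᶠ) A-& (All.map⁺ (All.map (λ g → lit-A-stable g _) global))

_[_≔_] : Valuation → Form → Bool → Valuation
(t [ a ≔ b ]) x = if does (x ≟ a) then b else t x

≔-agrees : ∀ a {x} → (x ≢ a → u x ≡ t x) → u x ≡ (t [ a ≔ u a ]) x
≔-agrees a {x} h with x ≟ a
... | yes refl = refl
... | no x≢a   = h x≢a

valuations : List Form → List Valuation
valuations []      = const false ∷ []
valuations (a ∷ Φ) = cartesianProductWith _[ a ≔_] (valuations Φ) (true ∷ false ∷ [])

valuations-complete : ∀ Φ u → ∃ λ t → t ∈ valuations Φ × Agree Φ u t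
valuations-complete []      u = const false , here refl , []
valuations-complete (a ∷ Φ) u =
  let t , t∈ , agree = valuations-complete Φ u in
  t [ a ≔ u a ] ,
  ∈-cartesianProductWith⁺ _[ a ≔_] t∈ (bool∈ (u a)) ,
  ≔-agrees {u} {t} a (λ a≢a → ⊥-elim (a≢a refl)) ∷
  All.map (λ eq → ≔-agrees {u} {t} a (const eq)) agree
  where
  bool∈ : ∀ b → b ∈ true ∷ false ∷ []
  bool∈ true  = here refl
  bool∈ false = there (here refl)

module Pruning {X : Set} (Good : List X → X → Set) (good? : ∀ L → Decidable (Good L))
               (Inv : List X → Set) (prune-inv : ∀ {L} → Inv L → Inv (filter (good? L) L)) where

  saturate : ∀ L → Inv L → ∃ λ L′ → Inv L′ × All (Good L′) L′
  saturate L = iterate (length L) L ≤-refl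
    where
    iterate : ∀ n L → length L ≤ n → Inv L → ∃ λ L′ → Inv L′ × All (Good L′) L′
    iterate n L _ inv with All.all? (good? L) L
    iterate n       L       _     inv | yes L-good = L , inv , L-good
    iterate zero    []      _     _   | no L-bad   = ⊥-elim (L-bad [])
    iterate (suc n) L       |L|≤n inv | no L-bad   =
      iterate n (filter (good? L) L) (s≤s⁻¹ (<-≤-trans shrinks |L|≤n)) (prune-inv inv)
      where
      shrinks : length (filter (good? L) L) < length L
      shrinks = filter-notAll (good? L) L (¬All⇒Any¬ (good? L) L L-bad)

module Elimination (Φ : List Form) (Φ-closed : ∀ {ψ} → ψ ∈ Φ → atoms ψ ⊆ Φ) where

  modals globals : List Form
  modals  = filter modal? Φ
  globals = filter global? Φ

  modals⊆Φ : modals ⊆ Φ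
  modals⊆Φ = proj₁ ∘ ∈-filter⁻ modal?

  globals⊆Φ : globals ⊆ Φ
  globals⊆Φ = proj₁ ∘ ∈-filter⁻ global?

  globals⊆modals : globals ⊆ modals
  globals⊆modals ψ∈ with ∈-filter⁻ global? {xs = Φ} ψ∈
  ... | ψ∈Φ , A-global ψ = ∈-filter⁺ modal? ψ∈Φ (A-modal ψ)

  S∈modals : S ψ ∈ Φ → S ψ ∈ modals
  S∈modals S∈ = ∈-filter⁺ modal? S∈ (S-modal _)

  A∈globals : A ψ ∈ Φ → A ψ ∈ globals
  A∈globals A∈ = ∈-filter⁺ global? A∈ (A-global _)

  char : Valuation → Form
  char t = ⟪ t ⟫ Φ

  ⊩-agree : Agree Φ (evalB u) t → atoms ψ ⊆ Φ → u ⊩ ψ → t ⊩ ψ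
  ⊩-agree {ψ = ψ} agree sub (holds h) =
    holds (trans (sym (evalB-atoms ψ (All.anti-mono sub agree))) h)

  ⊩-agree⁻ : Agree Φ (evalB u) t → atoms ψ ⊆ Φ → t ⊩ ψ → u ⊩ ψ
  ⊩-agree⁻ {ψ = ψ} agree sub (holds h) =
    holds (trans (evalB-atoms ψ (All.anti-mono sub agree)) h)

  Covers : List Valuation → Set
  Covers L = ⊢ ⋁ (map char L)

  covers-elim : ∀ {L} → Covers L → (∀ {t} → t ∈ L → ⊢ (char t ⇒ ψ)) → ⊢ ψ
  covers-elim {L = L} cov h = mp (⋁-elim each) cov
    where
    each : ∀ {γ} → γ ∈ map char L → ⊢ (γ ⇒ _)
    each γ∈ with ∈-map⁻ char γ∈
    ... | t , t∈ , refl = h t∈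

  covers-semantic : ∀ {L} → Covers L → (∀ {t} → t ∈ L → ∀ u → Agree Φ (evalB u) t → u ⊩ ψ) → ⊢ ψ
  covers-semantic cov h = covers-elim cov (⟪⟫-entails ∘ h)

  valuations-cover : Covers (valuations Φ)
  valuations-cover = ⊢-semantic λ w →
    let t , t∈ , agree = valuations-complete Φ (evalB w) in
    ⊩-⋁⁺ (lose (∈-map⁺ char t∈) (⊩-⟪⟫⁺ agree))

  refuted-by : ⊢ θ → (∀ u → Agree Φ (evalB u) t → ¬ u ⊩ θ) → ⊢ (~ char t)
  refuted-by {θ} {t} ⊢θ h = mp₂ glue (⟪⟫-entails λ u agree → ⊩-~⁺ (h u agree)) ⊢θ
    where
    glue : ⊢ ((char t ⇒ ~ θ) ⇒ θ ⇒ ~ char t)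
    glue = taut λ w →
      truth-table 2 (λ c x → (c ⇒ᵇ not x) ⇒ᵇ x ⇒ᵇ not c) (evalB w (char t)) (evalB w θ)

  SWitness AWitness : List Valuation → Valuation → Form → Set
  SWitness L t χ = Any (λ t′ → Agree modals t t′ × t′ ⊩ χ) L
  AWitness L t χ = Any (λ t′ → Agree globals t t′ × ¬ t′ ⊩ χ) L

  sWitness? : ∀ L t χ → Dec (SWitness L t χ)
  sWitness? L t χ = Any.any? (λ t′ → agree? modals t t′ ×-dec t′ ⊩? χ) L

  aWitness? : ∀ L t χ → Dec (AWitness L t χ)
  aWitness? L t χ = Any.any? (λ t′ → agree? globals t t′ ×-dec ¬? (t′ ⊩? χ)) L

  GoodAt : List Valuation → Valuation → Form → Set
  GoodAt L t (S χ)   = (t ⊩ χ → t ⊩ S χ) × (t ⊩ S χ → SWitness L t χ)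
  GoodAt L t (A χ)   = (t ⊩ A χ → t ⊩ χ) × (¬ t ⊩ A χ → AWitness L t χ)
  GoodAt L t (var _) = ⊤
  GoodAt L t (~ _)   = ⊤
  GoodAt L t (_ & _) = ⊤

  Good : List Valuation → Valuation → Set
  Good L t = All (GoodAt L t) Φ

  goodAt? : ∀ L t ψ → Dec (GoodAt L t ψ)
  goodAt? L t (S χ)   = (t ⊩? χ →-dec t ⊩? S χ) ×-dec (t ⊩? S χ →-dec sWitness? L t χ)
  goodAt? L t (A χ)   = (t ⊩? A χ →-dec t ⊩? χ) ×-dec (¬? (t ⊩? A χ) →-dec aWitness? L t χ)
  goodAt? L t (var _) = yes tt
  goodAt? L t (~ _)   = yes tt
  goodAt? L t (_ & _) = yes tt

  good? : ∀ L → Decidable (Good L)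
  good? L t = All.all? (goodAt? L t) Φ

  module _ {L : List Valuation} (cov : Covers L) where

    refute-S-witness : S χ ∈ Φ → t ⊩ S χ → ¬ SWitness L t χ → ⊢ (~ char t)
    refute-S-witness {χ} {t} S∈ tSχ no-witness =
      refuted-by (S-excludes (⟪⟫-□-stable (all-filter modal? Φ)) σ-excludes-χ) λ u agree uθ →
        ⊩-~⁻ (⊩-⇒⁻ uθ (⊩-⟪⟫⁺ (All.anti-mono modals⊆Φ agree))) (⊩-agree⁻ agree (Φ-closed S∈) tSχ)
      where
      σ-excludes-χ : ⊢ (~ (⟪ t ⟫ modals & χ))
      σ-excludes-χ = covers-semantic cov λ {t′} t′∈ u agree → ⊩-~⁺ λ uσχ →
        let uσ , uχ = ⊩-&⁻ uσχ in
        no-witness (lose t′∈ (Agree-trans (Agree-sym (⊩-⟪⟫⁻ uσ)) (All.anti-mono modals⊆Φ agree) ,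
                              ⊩-agree agree (Φ-closed S∈ ∘ there) uχ))

    refute-A-witness : A χ ∈ Φ → ¬ t ⊩ A χ → ¬ AWitness L t χ → ⊢ (~ char t)
    refute-A-witness {χ} {t} A∈ ¬tAχ no-witness =
      refuted-by (⇒-trans (⟪⟫-A-stable (all-filter global? Φ)) (A-mono α⇒χ)) λ u agree uθ →
        ¬tAχ (⊩-agree agree (Φ-closed A∈) (⊩-⇒⁻ uθ (⊩-⟪⟫⁺ (All.anti-mono globals⊆Φ agree))))
      where
      α⇒χ : ⊢ (⟪ t ⟫ globals ⇒ χ)
      α⇒χ = covers-semantic cov λ {t′} t′∈ u agree → ⊩-⇒⁺ λ uα →
        decidable-stable (u ⊩? χ) λ ¬uχ →
          no-witness (lose t′∈ (Agree-trans (Agree-sym (⊩-⟪⟫⁻ uα)) (All.anti-mono globals⊆Φ agree) ,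
                                ¬uχ ∘ ⊩-agree⁻ agree (Φ-closed A∈ ∘ there)))

    refute-S-local : S χ ∈ Φ → t ⊩ χ → ¬ t ⊩ S χ → ⊢ (~ char t)
    refute-S-local {χ} S∈ tχ ¬tSχ = refuted-by (ax-S2 χ) λ u agree uθ →
      ¬tSχ (⊩-agree agree (Φ-closed S∈) (⊩-⇒⁻ uθ (⊩-agree⁻ agree (Φ-closed S∈ ∘ there) tχ)))

    refute-A-local : A χ ∈ Φ → t ⊩ A χ → ¬ t ⊩ χ → ⊢ (~ char t)
    refute-A-local {χ} A∈ tAχ ¬tχ = refuted-by (ax-T χ) λ u agree uθ →
      ¬tχ (⊩-agree agree (Φ-closed A∈ ∘ there) (⊩-⇒⁻ uθ (⊩-agree⁻ agree (Φ-closed A∈) tAχ)))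

    refute-bad : ¬ Good L t → ⊢ (~ char t)
    refute-bad {t} bad =
      let ψ , ψ∈ , ¬good = find (¬All⇒Any¬ (goodAt? L t) Φ bad) in refute-at ψ ψ∈ ¬good
      where
      refute-at : ∀ ψ → ψ ∈ Φ → ¬ GoodAt L t ψ → ⊢ (~ char t)
      refute-at (var _) _ ¬good = ⊥-elim (¬good tt)
      refute-at (~ _)   _ ¬good = ⊥-elim (¬good tt)
      refute-at (_ & _) _ ¬good = ⊥-elim (¬good tt)
      refute-at (S χ) S∈ ¬good with t ⊩? S χ | t ⊩? χ
      ... | yes tSχ | _      = refute-S-witness S∈ tSχ λ w → ¬good (const tSχ , const w)
      ... | no ¬tSχ | yes tχ = refute-S-local S∈ tχ ¬tSχ
      ... | no ¬tSχ | no ¬tχ = ⊥-elim (¬good (⊥-elim ∘ ¬tχ , ⊥-elim ∘ ¬tSχ))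
      refute-at (A χ) A∈ ¬good with t ⊩? A χ | t ⊩? χ
      ... | no ¬tAχ | _      = refute-A-witness A∈ ¬tAχ λ w → ¬good (⊥-elim ∘ ¬tAχ , const w)
      ... | yes tAχ | no ¬tχ = refute-A-local A∈ tAχ ¬tχ
      ... | yes tAχ | yes tχ = ⊥-elim (¬good (const tχ , λ ¬tAχ → ⊥-elim (¬tAχ tAχ)))

  prune-covers : ∀ {L} → Covers L → Covers (filter (good? L) L)
  prune-covers {L} cov = covers-elim cov keep
    where
    keep : ∀ {t} → t ∈ L → ⊢ (char t ⇒ ⋁ (map char (filter (good? L) L)))
    keep {t} t∈ with good? L t
    ... | yes good = ⋁-intro (∈-map⁺ char (∈-filter⁺ (good? L) t∈ good))
    ... | no bad   = ex-falso (refute-bad cov bad)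

  module Canonical (L : List Valuation) (L-good : All (Good L) L) (t₀ : Valuation) where

    record World : Set where
      constructor world
      field
        type      : Valuation
        type∈L    : type ∈ L
        t₀≈type   : Agree globals t₀ type
    open World

    frame : Frame
    frame = record
      { X     = World
      ; P     = λ U → ∀ {x y} → Agree modals (type x) (type y) → U x → U y
      ; P-ext = λ U⊆V V⊆U U-closed x≈y Vx → U⊆V _ (U-closed x≈y (V⊆U _ Vx))
      ; P1    = λ _ _ → tt
      ; P2    = λ U-closed x≈y ¬Ux Uy → ¬Ux (U-closed (Agree-sym x≈y) Uy)
      ; P3    = λ _ _ U-closed x≈y Ux i → U-closed i x≈y (Ux i)
      }

    model : Model
    model = record { frame = frame ; val = λ p x → type x ⊩ var p }

    good-at : ∀ x → ψ ∈ Φ → GoodAt L (type x) ψ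
    good-at x = All.lookup (All.lookup L-good (type∈L x))

    ⊩⇒⊨ : ∀ ψ → atoms ψ ⊆ Φ → ∀ x → type x ⊩ ψ → model , x ⊨ ψ
    ⊨⇒⊩ : ∀ ψ → atoms ψ ⊆ Φ → ∀ x → model , x ⊨ ψ → type x ⊩ ψ

    ⊩⇒⊨ (var p) _ x h = lift h
    ⊩⇒⊨ (~ ψ) sub x h = ⊩-~⁻ h ∘ ⊨⇒⊩ ψ sub x
    ⊩⇒⊨ (ψ & χ) sub x h =
      ⊩⇒⊨ ψ (sub ∘ ∈-++⁺ˡ) x (proj₁ (⊩-&⁻ h)) , ⊩⇒⊨ χ (sub ∘ ∈-++⁺ʳ (atoms ψ)) x (proj₂ (⊩-&⁻ h))
    ⊩⇒⊨ (S ψ) sub x h U U-closed ψ⊆U =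
      let t , t∈ , x≈t , tψ = find (proj₂ (good-at x (sub (here refl))) h)
          y = world t t∈ (Agree-trans (t₀≈type x) (All.anti-mono globals⊆modals x≈t))
      in U-closed (Agree-sym x≈t) (ψ⊆U y (⊩⇒⊨ ψ (sub ∘ there) y tψ))
    ⊩⇒⊨ (A ψ) sub x h y = ⊩⇒⊨ ψ (sub ∘ there) y (proj₁ (good-at y (sub (here refl))) yAψ)
      where
      yAψ : type y ⊩ A ψ
      yAψ = ⊩-agree-modal (A-modal ψ) (A∈globals (sub (here refl)))
              (Agree-trans (Agree-sym (t₀≈type x)) (t₀≈type y)) h

    ⊨⇒⊩ (var p) _ x h = lower h
    ⊨⇒⊩ (~ ψ) sub x h = ⊩-~⁺ (h ∘ ⊩⇒⊨ ψ sub x)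
    ⊨⇒⊩ (ψ & χ) sub x (hψ , hχ) =
      ⊩-&⁺ (⊨⇒⊩ ψ (sub ∘ ∈-++⁺ˡ) x hψ) (⊨⇒⊩ χ (sub ∘ ∈-++⁺ʳ (atoms ψ)) x hχ)
    ⊨⇒⊩ (S ψ) sub x h = h (λ z → type z ⊩ S ψ) (λ {y} {z} → Sψ-closed {y} {z}) ψ⇒Sψ
      where
      Sψ-closed : ∀ {y z} → Agree modals (type y) (type z) → type y ⊩ S ψ → type z ⊩ S ψ
      Sψ-closed = ⊩-agree-modal (S-modal ψ) (S∈modals (sub (here refl)))
      ψ⇒Sψ : ∀ y → model , y ⊨ ψ → type y ⊩ S ψ
      ψ⇒Sψ y hψ = proj₁ (good-at y (sub (here refl))) (⊨⇒⊩ ψ (sub ∘ there) y hψ)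
    ⊨⇒⊩ (A ψ) sub x h = decidable-stable (type x ⊩? A ψ) λ ¬hA →
      let t , t∈ , x≈t , ¬tψ = find (proj₂ (good-at x (sub (here refl))) ¬hA)
          y = world t t∈ (Agree-trans (t₀≈type x) x≈t)
      in ¬tψ (⊨⇒⊩ ψ (sub ∘ there) y (h y))

lemma4 : ∀ (φ : Form) → Valid φ → ⊢ φ
lemma4 φ valid =
  let L , covers , L-good = saturate (valuations (atoms φ)) valuations-cover in
  covers-semantic covers λ {t} t∈ u u≈t →
    let open Canonical L L-good t
        x = world t t∈ Agree-refl
    in ⊩-agree⁻ u≈t id (⊨⇒⊩ φ id x (valid model x))
  where
  open Elimination (atoms φ) (atoms-closed φ)
  open Pruning Good good? Covers prune-covers
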